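{- Let $k$ be a positive integer and let $G$ be a finite connected graph with $n$ vertices and $2n-2-k$ edges. Then $wp(G)\le 2^k$.
   Context: A configuration of pebbles on a graph $G$ is a function $C:V(G)\to\mathbb{N}$; its size is $\sum_{v}C(v)$. A weight distribution $W$ on $G$ assigns to each edge $e$ a weight $w_e$ with $0\le w_e\le 1$; its total weight is $|W|=\sum_{e\in E(G)}w_e$, and $G_W$ denotes the resulting weighted graph. A pebbling step along an edge $uv$ of weight $w$ removes $k$ pebbles from $u$ (for some positive integer $k$ not exceeding the number of pebbles on $u$) and adds $\lfloor wk\rfloor$ pebbles to $v$. A target vertex $t$ can be reached from a configuration $C$ if some sequence of pebbling steps yields a configuration with at least one pebble on $t$. $G_W$ is $p$-solvable if every configuration of $p$ pebbles can reach every target vertex. The weighted pebbling number $wp(G)$ of the unweighted graph $G$ is the smallest positive integer $p$ for which there exists a weight distribution $W$ on $G$ with $|W|=|E(G)|/2$ such that $G_W$ is $p$-solvable. -}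

module Defs where

open import Data.Nat as ℕ using (ℕ; suc; _≤_; _∸_)
open import Data.Integer as ℤ using (ℤ; +_)
open import Data.Rational as ℚ using (ℚ; 0ℚ; 1ℚ; floor)
open import Data.Fin using (Fin; _<_)
open import Data.Fin.Properties using (_≟_)
open import Data.List using (List; length; lookup; map; foldr; allFin)
open import Data.Nat.ListAction using (sum)
open import Data.List.Relation.Unary.All using (All)
open import Data.List.Relation.Unary.Unique.Propositional using (Unique)
open import Data.List.Membership.Propositional using (_∈_)
open import Data.Product using (_×_; _,_; proj₁; proj₂; ∃; ∃-syntax)
open import Data.Sum using (_⊎_)
open import Data.Bool using (if_then_else_)
open import Relation.Nullary using (does)
open import Relation.Binary.PropositionalEquality using (_≡_)
open import Relation.Binary.Construct.Closure.ReflexiveTransitive using (Star)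

-- Each undirected edge {a,b} is stored once as (a , b) with a < b
-- (so no loops), and the list has no repetitions (so no multi-edges).
record Graph (n : ℕ) : Set where
  field
    edges    : List (Fin n × Fin n)
    ordered  : All (λ e → proj₁ e < proj₂ e) edges
    distinct : Unique edges

open Graph public

∣E∣ : ∀ {n} → Graph n → ℕ
∣E∣ G = length (edges G)

Edge : ∀ {n} → Graph n → Set
Edge G = Fin (∣E∣ G)

endpoints : ∀ {n} (G : Graph n) → Edge G → Fin n × Fin n
endpoints G e = lookup (edges G) e

Adj : ∀ {n} → Graph n → Fin n → Fin n → Set
Adj G u v = ((u , v) ∈ edges G) ⊎ ((v , u) ∈ edges G)

Connected : ∀ {n} → Graph n → Set
Connected {n} G = (u v : Fin n) → Star (Adj G) u v

WeightFn : ∀ {n} → Graph n → Set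
WeightFn G = Edge G → ℚ

totalWeight : ∀ {n} (G : Graph n) → WeightFn G → ℚ
totalWeight G W = foldr ℚ._+_ 0ℚ (map W (allFin (∣E∣ G)))

IsWeightDistribution : ∀ {n} (G : Graph n) → WeightFn G → Set
IsWeightDistribution G W = (e : Edge G) → (0ℚ ℚ.≤ W e) × (W e ℚ.≤ 1ℚ)

HalfTotal : ∀ {n} (G : Graph n) → WeightFn G → Set
HalfTotal G W = totalWeight G W ≡ (+ ∣E∣ G) ℚ./ 2

Config : ℕ → Set
Config n = Fin n → ℕ

size : ∀ {n} → Config n → ℕ
size {n} C = sum (map C (allFin n))

floorMul : ℚ → ℕ → ℕ
floorMul w k = ℤ.∣ floor (w ℚ.* ((+ k) ℚ./ 1)) ∣

move : ∀ {n} → Config n → Fin n → Fin n → ℕ → ℕ → Config n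
move C u v k g x =
  if does (x ≟ v) then C x ℕ.+ g
  else (if does (x ≟ u) then C x ∸ k else C x)

data Step {n} (G : Graph n) (W : WeightFn G) : Config n → Config n → Set where
  step : (C : Config n) (e : Edge G) (u v : Fin n) →
         ((u ≡ proj₁ (endpoints G e) × v ≡ proj₂ (endpoints G e))
           ⊎ (u ≡ proj₂ (endpoints G e) × v ≡ proj₁ (endpoints G e))) →
         (k : ℕ) → 1 ≤ k → k ≤ C u →
         Step G W C (move C u v k (floorMul (W e) k))

Reaches : ∀ {n} (G : Graph n) (W : WeightFn G) → Config n → Fin n → Set
Reaches {n} G W C t = ∃[ C' ] (Star (Step G W) C C' × (1 ≤ C' t))

Solvable : ∀ {n} (G : Graph n) (W : WeightFn G) → ℕ → Set
Solvable {n} G W p = (C : Config n) → size C ≡ p → (t : Fin n) → Reaches G W C t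

-- wp(G) ≤ m : the least positive p admitting a weight distribution W with
-- |W| = |E|/2 and G_W p-solvable is ≤ m, i.e. some such p ≤ m exists.
WpAtMost : ∀ {n} → Graph n → ℕ → Set
WpAtMost G m =
  ∃[ p ] (1 ≤ p × p ≤ m ×
    ∃[ W ] (IsWeightDistribution G W × HalfTotal G W × Solvable G W p))

module Submission where

-- Write n = m + 1.  A breadth-first-search tree of G has m distinct edges,
-- so k ≤ m.  Give the first k tree edges weight 1/2, the other m − k tree
-- edges weight 1 and every other edge weight 0: the total is (2m − k)/2,
-- which is |E|/2.  To bring a pebble to a target t from 2 ^ k pebbles, run a
-- second breadth-first search, inside the tree, from t, and empty the
-- vertices one at a time, farthest from t first, each onto its tree
-- neighbour closer to t.  Every tree edge is crossed by exactly one vertex,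
-- and crossing an edge of weight 1/2 with a ≤ S of the S pebbles leaves at
-- least ⌊S/2⌋ of them; so the number of pebbles is halved at most k times,
-- and at the end all of the remaining (at least one) pebbles lie on t.

open import Defs
open import Data.Nat as ℕ using (ℕ; zero; suc; _+_; _*_; _^_; _≤_; _<_; _∸_; z≤n; s≤s; NonZero)
open import Data.Nat.Properties hiding (_≟_)
open import Data.Nat.DivMod using (_/_; m*n/n≡m; /-monoˡ-≤; +-distrib-/-∣ˡ; m/n*n≤m; n/1≡n)
open import Data.Nat.Divisibility using (n∣m*n)
open import Data.Nat.Induction using (<-rec)
open import Data.Nat.Tactic.RingSolver using (solve-∀)
open import Data.Fin using (Fin; toℕ) renaming (zero to fzero; suc to fsuc)
open import Data.Fin.Properties using (_≟_)
import Data.Fin.Properties as Fin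
open import Data.List using (map; foldr; tabulate)
open import Data.List.Relation.Unary.Any using (index)
open import Data.List.Relation.Unary.Any.Properties using (lookup-index)
open import Data.List.Membership.DecPropositional using () renaming (_∈?_ to member?)
import Data.Vec.Functional as Vec
open import Data.Bool using (if_then_else_)
open import Data.Empty using (⊥-elim)
open import Data.Unit using (tt)
open import Data.Product using (∃; _×_; _,_; proj₁; proj₂)
import Data.Product.Properties as Product
open import Data.Sum using (_⊎_; inj₁; inj₂)
open import Data.Integer as ℤ using (-[1+_]) renaming (+_ to pos)
import Data.Integer.Properties as ℤ
open import Data.Integer.Tactic.RingSolver using () renaming (solve-∀ to ℤ-solve-∀)
open import Data.Rational as ℚ using (ℚ; 0ℚ; 1ℚ; mkℚ)
import Data.Rational.Properties as ℚ
open import Data.Rational.Unnormalised as ℚᵘ using (mkℚᵘ; *≡*)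
import Data.Rational.Unnormalised.Properties as ℚᵘ
open import Function using (_∘_)
open import Relation.Nullary using (does; yes; no; ¬_; Dec)
open import Relation.Nullary.Decidable using (_⊎-dec_; _×-dec_; toWitness)
open import Relation.Binary.Definitions using (tri<; tri≈; tri>)
open import Relation.Binary.PropositionalEquality
open import Relation.Binary.Construct.Closure.ReflexiveTransitive using (Star; ε; _◅_; _◅◅_; reverse)
open import Algebra.Properties.CommutativeMonoid.Sum +-0-commutativeMonoid
  using (∑-distrib-+; ∑-comm; sum-cong-≗)
  renaming (sum to ∑)

foldr-tabulate : ∀ {A B C : Set} (_∙_ : B → C → C) (e : C) n (g : Fin n → A) (f : A → B) →
                 foldr _∙_ e (map f (tabulate g)) ≡ Vec.foldr _∙_ e (λ i → f (g i))
foldr-tabulate _∙_ e zero    g f = refl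
foldr-tabulate _∙_ e (suc n) g f = cong (f (g fzero) ∙_) (foldr-tabulate _∙_ e n (λ i → g (fsuc i)) f)

size-∑ : ∀ {n} (C : Config n) → size C ≡ ∑ C
size-∑ {n} C = foldr-tabulate _+_ 0 n (λ i → i) C

∑-mono : ∀ {n} {f g : Fin n → ℕ} → (∀ i → f i ≤ g i) → ∑ f ≤ ∑ g
∑-mono {zero}  f≤g = z≤n
∑-mono {suc n} f≤g = +-mono-≤ (f≤g fzero) (∑-mono (λ i → f≤g (fsuc i)))

≤-∑ : ∀ {n} (f : Fin n → ℕ) i → f i ≤ ∑ f
≤-∑ f fzero    = m≤m+n (f fzero) _
≤-∑ f (fsuc i) = ≤-trans (≤-∑ (λ j → f (fsuc j)) i) (m≤n+m _ (f fzero))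

∑-zero : ∀ {n} {f : Fin n → ℕ} → (∀ i → f i ≡ 0) → ∑ f ≡ 0
∑-zero {zero}  f≡0 = refl
∑-zero {suc n} f≡0 = cong₂ _+_ (f≡0 fzero) (∑-zero (λ i → f≡0 (fsuc i)))

∑-single : ∀ {n} (f : Fin n → ℕ) a → (∀ i → i ≢ a → f i ≡ 0) → ∑ f ≡ f a
∑-single f fzero    off = trans (cong (f fzero +_) (∑-zero (λ i → off (fsuc i) (λ ())))) (+-identityʳ _)
∑-single f (fsuc a) off = trans (cong (_+ ∑ (λ i → f (fsuc i))) (off fzero (λ ())))
                                (∑-single (λ i → f (fsuc i)) a (λ i i≢a → off (fsuc i) (λ { refl → i≢a refl })))

balance : ∀ {S S' a g} → a ≤ S → S' + a ≡ S + g → S' ≡ (S ∸ a) + g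
balance {S} {S'} {a} {g} a≤S eq = begin
  S'              ≡⟨ m+n∸n≡m S' a ⟨
  S' + a ∸ a      ≡⟨ cong (_∸ a) eq ⟩
  S + g ∸ a       ≡⟨ cong (_∸ a) (+-comm S g) ⟩
  g + S ∸ a       ≡⟨ +-∸-assoc g a≤S ⟩
  g + (S ∸ a)     ≡⟨ +-comm g (S ∸ a) ⟩
  (S ∸ a) + g     ∎
  where open ≡-Reasoning

transfer-keeps-share : ∀ {S S' a g} d .{{_ : NonZero d}} →
                       a ≤ S → a / d ≤ g → S' + a ≡ S + g → S / d ≤ S'
transfer-keeps-share {S} {S'} {a} {g} d a≤S a/d≤g eq = begin
  S / d                    ≡⟨ cong (_/ d) (m∸n+n≡m a≤S) ⟨
  ((S ∸ a) + a) / d        ≤⟨ /-monoˡ-≤ d (+-monoˡ-≤ a (m≤m*n (S ∸ a) d)) ⟩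
  ((S ∸ a) * d + a) / d    ≡⟨ +-distrib-/-∣ˡ a (n∣m*n (S ∸ a)) ⟩
  (S ∸ a) * d / d + a / d  ≡⟨ cong (_+ a / d) (m*n/n≡m (S ∸ a) d) ⟩
  (S ∸ a) + a / d          ≤⟨ +-monoʳ-≤ (S ∸ a) a/d≤g ⟩
  (S ∸ a) + g              ≡⟨ balance a≤S eq ⟨
  S'                       ∎
  where open ≤-Reasoning

infixl 7 _/2^_
_/2^_ : ℕ → ℕ → ℕ
a /2^ c = a / 2 ^ c
  where instance _ = m^n≢0 2 c

transfer-keeps-power : ∀ {S S' a g} h c → 2 ^ (h + c) ≤ S →
                       a ≤ S → a /2^ c ≤ g → S' + a ≡ S + g → 2 ^ h ≤ S'
transfer-keeps-power {S} {S'} h c bound a≤S a/d≤g eq = begin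
  2 ^ h                    ≡⟨ m*n/n≡m (2 ^ h) (2 ^ c) ⟨
  2 ^ h * 2 ^ c / 2 ^ c    ≡⟨ cong (_/ 2 ^ c) (^-distribˡ-+-* 2 h c) ⟨
  2 ^ (h + c) / 2 ^ c      ≤⟨ /-monoˡ-≤ (2 ^ c) bound ⟩
  S / 2 ^ c                ≤⟨ transfer-keeps-share (2 ^ c) a≤S a/d≤g eq ⟩
  S'                       ∎
  where
  open ≤-Reasoning
  instance _ = m^n≢0 2 c

if-yes : ∀ {A P : Set} {x y : A} → P → (d : Dec P) → (if does d then x else y) ≡ x
if-yes p (yes _) = refl
if-yes p (no ¬p) = ⊥-elim (¬p p)

if-no : ∀ {A P : Set} {x y : A} → ¬ P → (d : Dec P) → (if does d then x else y) ≡ y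
if-no ¬p (yes p) = ⊥-elim (¬p p)
if-no ¬p (no _)  = refl

gate : ∀ {P : Set} → Dec P → ℕ → ℕ
gate d c = if does d then c else 0

gate-≤ : ∀ {P : Set} {c} → (d : Dec P) → gate d c ≤ c
gate-≤ (yes _) = ≤-refl
gate-≤ (no _)  = z≤n

gate-mono : ∀ {P Q : Set} {c} → (P → Q) → (d : Dec P) (d′ : Dec Q) → gate d c ≤ gate d′ c
gate-mono P⇒Q (yes p) d′ = ≤-reflexive (sym (if-yes (P⇒Q p) d′))
gate-mono P⇒Q (no _)  d′ = z≤n

pile : ∀ {n} → Fin n → ℕ → Config n
pile a c x = gate (x ≟ a) c

∑-pile : ∀ {n} (a : Fin n) c → ∑ (pile a c) ≡ c
∑-pile a c = trans (∑-single (pile a c) a (λ x x≢a → if-no x≢a (x ≟ a))) (if-yes refl (a ≟ a))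

move-pointwise : ∀ {n} (C : Config n) u v k g → u ≢ v → k ≤ C u → ∀ x →
                 move C u v k g x + pile u k x ≡ C x + pile v g x
move-pointwise C u v k g u≢v k≤Cu x with x ≟ v | x ≟ u
... | yes refl | yes refl = ⊥-elim (u≢v refl)
... | yes refl | no  _    = +-identityʳ _
... | no  _    | yes refl = trans (m∸n+n≡m k≤Cu) (sym (+-identityʳ _))
... | no  _    | no  _    = refl

move-size : ∀ {n} (C : Config n) u v k g → u ≢ v → k ≤ C u →
            size (move C u v k g) + k ≡ size C + g
move-size C u v k g u≢v k≤Cu = begin
  size C' + k                         ≡⟨ cong₂ _+_ (size-∑ C') (sym (∑-pile u k)) ⟩
  ∑ C' + ∑ (pile u k)                 ≡⟨ ∑-distrib-+ C' (pile u k) ⟨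
  ∑ (λ x → C' x + pile u k x)         ≡⟨ sum-cong-≗ (move-pointwise C u v k g u≢v k≤Cu) ⟩
  ∑ (λ x → C x + pile v g x)          ≡⟨ ∑-distrib-+ C (pile v g) ⟩
  ∑ C + ∑ (pile v g)                  ≡⟨ cong₂ _+_ (sym (size-∑ C)) (∑-pile v g) ⟩
  size C + g                          ∎
  where
  open ≡-Reasoning
  C' = move C u v k g

move-elsewhere : ∀ {n} (C : Config n) u v k g x → x ≢ u → x ≢ v → move C u v k g x ≡ C x
move-elsewhere C u v k g x x≢u x≢v with x ≟ v | x ≟ u
... | yes x≡v | _       = ⊥-elim (x≢v x≡v)
... | no  _   | yes x≡u = ⊥-elim (x≢u x≡u)
... | no  _   | no  _   = refl

move-empties : ∀ {n} (C : Config n) u v g → u ≢ v → move C u v (C u) g u ≡ 0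
move-empties C u v g u≢v with u ≟ v | u ≟ u
... | yes u≡v | _       = ⊥-elim (u≢v u≡v)
... | no  _   | yes _   = n∸n≡0 (C u)
... | no  _   | no  u≢u = ⊥-elim (u≢u refl)

-- Ranking vertices lexicographically by (level, index) refines the levels
-- into an injective order.
rank : ∀ {n} → (Fin n → ℕ) → Fin n → ℕ
rank {n} level x = level x * n + toℕ x

module _ {n} (level : Fin n → ℕ) where

  rank-monotone : ∀ x y → level x < level y → rank level x < rank level y
  rank-monotone x y lx<ly = begin-strict
    level x * n + toℕ x  <⟨ +-monoʳ-< (level x * n) (Fin.toℕ<n x) ⟩
    level x * n + n      ≡⟨ +-comm (level x * n) n ⟩
    suc (level x) * n    ≤⟨ *-monoˡ-≤ n lx<ly ⟩
    level y * n          ≤⟨ m≤m+n (level y * n) (toℕ y) ⟩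
    level y * n + toℕ y  ∎
    where open ≤-Reasoning

  rank-injective : ∀ x y → rank level x ≡ rank level y → x ≡ y
  rank-injective x y eq with <-cmp (level x) (level y)
  ... | tri< lx<ly _ _ = ⊥-elim (<⇒≢ (rank-monotone x y lx<ly) eq)
  ... | tri> _ _ ly<lx = ⊥-elim (>⇒≢ (rank-monotone y x ly<lx) eq)
  ... | tri≈ _ lx≡ly _ =
    Fin.toℕ-injective (+-cancelˡ-≡ (level x * n) _ _ (trans eq (cong (λ l → l * n + toℕ y) (sym lx≡ly))))

  rank-ground : ∀ x → level x ≡ 0 → rank level x < n
  rank-ground x lx≡0 = subst (λ l → l * n + toℕ x < n) (sym lx≡0) (Fin.toℕ<n x)

  rank-raised : ∀ x → 1 ≤ level x → n ≤ rank level x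
  rank-raised x 1≤lx = ≤-trans (≤-trans (m≤m*n n (level x) {{ℕ.>-nonZero 1≤lx}}) (≤-reflexive (*-comm n (level x))))
                               (m≤m+n (level x * n) (toℕ x))

Along : ∀ {n} (G : Graph n) → Edge G → Fin n → Fin n → Set
Along G e u v = (u ≡ proj₁ (endpoints G e) × v ≡ proj₂ (endpoints G e))
              ⊎ (u ≡ proj₂ (endpoints G e) × v ≡ proj₁ (endpoints G e))

module _ {n} (G : Graph n) where

  Along-sym : ∀ {e u v} → Along G e u v → Along G e v u
  Along-sym (inj₁ (u≡ , v≡)) = inj₂ (v≡ , u≡)
  Along-sym (inj₂ (u≡ , v≡)) = inj₁ (v≡ , u≡)

  Along-unique : ∀ {e u v u′ v′} → Along G e u v → Along G e u′ v′ →
                 (u ≡ u′ × v ≡ v′) ⊎ (u ≡ v′ × v ≡ u′)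
  Along-unique (inj₁ (p , q)) (inj₁ (p′ , q′)) = inj₁ (trans p (sym p′) , trans q (sym q′))
  Along-unique (inj₁ (p , q)) (inj₂ (p′ , q′)) = inj₂ (trans p (sym q′) , trans q (sym p′))
  Along-unique (inj₂ (p , q)) (inj₁ (p′ , q′)) = inj₂ (trans p (sym q′) , trans q (sym p′))
  Along-unique (inj₂ (p , q)) (inj₂ (p′ , q′)) = inj₁ (trans p (sym p′) , trans q (sym q′))

  adjacent-edge : ∀ {u v} → Adj G u v → ∃ λ e → Along G e u v
  adjacent-edge (inj₁ uv∈E) = let p = lookup-index uv∈E in index uv∈E , inj₁ (cong proj₁ p , cong proj₂ p)
  adjacent-edge (inj₂ vu∈E) = let p = lookup-index vu∈E in index vu∈E , inj₂ (cong proj₂ p , cong proj₁ p)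

  adjacent? : ∀ u v → Dec (Adj G u v)
  adjacent? u v = member? pair≟ (u , v) (edges G) ⊎-dec member? pair≟ (v , u) (edges G)
    where pair≟ = Product.≡-dec _≟_ _≟_

-- How vertex x passes its pebbles on: along an edge to a vertex of lower
-- level, through a channel j reserved for x, at a rounding cost of cost j
-- halvings (pushing a pebbles delivers at least a / 2 ^ cost j).
record Route {n} (G : Graph n) (W : WeightFn G) {m} (cost : Fin m → ℕ)
             (user : Fin m → Fin n) (level : Fin n → ℕ) (x : Fin n) : Set where
  field
    next     : Fin n
    edge     : Edge G
    along    : Along G edge x next
    channel  : Fin m
    reserved : user channel ≡ x
    delivers : ∀ a → a /2^ cost channel ≤ floorMul (W edge) a
    descends : level next < level x

-- Vertices
-- are emptied one by one in decreasing rank; when the vertex of rank R is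
-- emptied, the vertices of higher rank are already empty and at least
-- 2 ^ (cost of the channels used at ranks below R) pebbles remain.
module Funnel {n} (G : Graph n) (W : WeightFn G) (t : Fin n)
  {m} (cost : Fin m → ℕ) (user : Fin m → Fin n)
  (level : Fin n → ℕ) (level-t : level t ≡ 0)
  (route : ∀ x → x ≢ t → Route G W cost user level x) where

  ρ : Fin n → ℕ
  ρ = rank level

  -- the cost of channel j if it is still to be used below rank R
  due : ℕ → Fin m → ℕ
  due R j = gate (ρ (user j) ℕ.<? R) (cost j)

  pending : ℕ → ℕ
  pending R = ∑ (due R)

  due-mono : ∀ R j → due R j ≤ due (suc R) j
  due-mono R j = gate-mono m≤n⇒m≤1+n (ρ (user j) ℕ.<? R) (ρ (user j) ℕ.<? suc R)

  due-≤-cost : ∀ R j → due R j ≤ cost j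
  due-≤-cost R j = gate-≤ (ρ (user j) ℕ.<? R)

  due-step : ∀ R j i → ρ (user j) ≡ R → due R i + pile j (cost j) i ≤ due (suc R) i
  due-step R j i ρj≡R with i ≟ j
  ... | yes refl = begin
    due R j + cost j   ≡⟨ cong (_+ cost j) (if-no (<-irrefl ρj≡R) (ρ (user j) ℕ.<? R)) ⟩
    cost j             ≡⟨ if-yes (s≤s (≤-reflexive ρj≡R)) (ρ (user j) ℕ.<? suc R) ⟨
    due (suc R) j      ∎
    where open ≤-Reasoning
  ... | no _ = ≤-trans (≤-reflexive (+-identityʳ _)) (due-mono R i)

  pending-step : ∀ R j → ρ (user j) ≡ R → pending R + cost j ≤ pending (suc R)
  pending-step R j ρj≡R = begin
    pending R + cost j                       ≡⟨ cong (pending R +_) (∑-pile j (cost j)) ⟨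
    ∑ (due R) + ∑ (pile j (cost j))          ≡⟨ ∑-distrib-+ (due R) (pile j (cost j)) ⟨
    ∑ (λ i → due R i + pile j (cost j) i)    ≤⟨ ∑-mono (λ i → due-step R j i ρj≡R) ⟩
    pending (suc R)                          ∎
    where open ≤-Reasoning

  Swept : ℕ → Config n → Set
  Swept R C = (∀ x → R ≤ ρ x → C x ≡ 0) × 2 ^ pending R ≤ size C

  -- A vertex with a route lies above a lower vertex, so at rank ≥ n.
  raised : ∀ x → x ≢ t → n ≤ ρ x
  raised x x≢t = rank-raised level x (≤-trans (s≤s z≤n) (Route.descends (route x x≢t)))

  skip : ∀ R C → Swept (suc R) C → (∀ x → ρ x ≡ R → C x ≡ 0) → Swept R C
  skip R C (empty , enough) emptyR = empty′ , ≤-trans (^-monoʳ-≤ 2 (∑-mono (due-mono R))) enough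
    where
    empty′ : ∀ x → R ≤ ρ x → C x ≡ 0
    empty′ x R≤ρx with m≤n⇒m<n∨m≡n R≤ρx
    ... | inj₁ R<ρx = empty x R<ρx
    ... | inj₂ R≡ρx = emptyR x (sym R≡ρx)

  push : ∀ R C x → ρ x ≡ R → x ≢ t → C x ≢ 0 → Swept (suc R) C →
         ∃ λ C′ → Step G W C C′ × Swept R C′
  push R C x ρx≡R x≢t Cx≢0 (empty , enough) = C′ , step′ , empty′ , enough′
    where
    open Route (route x x≢t)
    a = C x
    g = floorMul (W edge) a
    C′ = move C x next a g
    next<x : ρ next < ρ x
    next<x = rank-monotone level next x descends
    x≢next : x ≢ next
    x≢next x≡next = <-irrefl (cong ρ (sym x≡next)) next<x
    step′ : Step G W C C′
    step′ = step C edge x next along a (n≢0⇒n>0 Cx≢0) ≤-refl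
    empty′ : ∀ y → R ≤ ρ y → C′ y ≡ 0
    empty′ y R≤ρy = emptied (y ≟ x)
      where
      emptied : Dec (y ≡ x) → C′ y ≡ 0
      emptied (yes refl) = move-empties C x next g x≢next
      emptied (no y≢x)   = trans (move-elsewhere C x next a g y y≢x y≢next) (empty y R<ρy)
        where
        R<ρy : R < ρ y
        R<ρy = ≤∧≢⇒< R≤ρy (λ R≡ρy → y≢x (rank-injective level y x (trans (sym R≡ρy) (sym ρx≡R))))
        y≢next : y ≢ next
        y≢next refl = <-irrefl refl (≤-trans next<x (≤-trans (≤-reflexive ρx≡R) R≤ρy))
    enough′ : 2 ^ pending R ≤ size C′
    enough′ = transfer-keeps-power (pending R) (cost channel)
      (≤-trans (^-monoʳ-≤ 2 (pending-step R channel (trans (cong ρ reserved) ρx≡R))) enough)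
      (≤-trans (≤-∑ C x) (≤-reflexive (sym (size-∑ C))))
      (delivers a)
      (move-size C x next a g x≢next ≤-refl)

  not-target : ∀ x → n ≤ ρ x → x ≢ t
  not-target x n≤ρx refl = <⇒≱ (rank-ground level t level-t) n≤ρx

  lower : ∀ R C → n ≤ R → Swept (suc R) C → ∃ λ C′ → Star (Step G W) C C′ × Swept R C′
  lower R C n≤R swept with Fin.any? (λ x → ρ x ℕ.≟ R)
  ... | no  none = C , ε , skip R C swept (λ x ρx≡R → ⊥-elim (none (x , ρx≡R)))
  ... | yes (x , ρx≡R) with C x ℕ.≟ 0
  ...   | yes Cx≡0 = C , ε , skip R C swept
                       (λ y ρy≡R → trans (cong C (rank-injective level y x (trans ρy≡R (sym ρx≡R)))) Cx≡0)
  ...   | no  Cx≢0 =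
    let (C′ , step′ , swept′) = push R C x ρx≡R (not-target x (subst (n ≤_) (sym ρx≡R) n≤R)) Cx≢0 swept
    in C′ , step′ ◅ ε , swept′

  sweep : ∀ d C → Swept (d + n) C → ∃ λ C′ → Star (Step G W) C C′ × Swept n C′
  sweep zero    C swept = C , ε , swept
  sweep (suc d) C swept =
    let (C₁ , steps₁ , swept₁) = lower (d + n) C (m≤n+m n d) swept
        (C′ , steps′ , swept′) = sweep d C₁ swept₁
    in C′ , steps₁ ◅◅ steps′ , swept′

  swept-target : ∀ C → Swept n C → 1 ≤ C t
  swept-target C (empty , enough) = subst (1 ≤_) size≡Ct (≤-trans (m^n>0 2 (pending n)) enough)
    where
    size≡Ct : size C ≡ C t
    size≡Ct = trans (size-∑ C) (∑-single C t (λ y y≢t → empty y (raised y y≢t)))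

  -- Start above every rank: nothing needs to be empty yet, and every
  -- channel is still to be paid for.
  reaches : ∀ C → 2 ^ ∑ cost ≤ size C → Reaches G W C t
  reaches C enough =
    let (C′ , steps , swept) = sweep top C (above-all , ≤-trans (^-monoʳ-≤ 2 (∑-mono (due-≤-cost (top + n)))) enough)
    in C′ , steps , swept-target C′ swept
    where
    top = suc (∑ ρ)
    above-all : ∀ x → top + n ≤ ρ x → C x ≡ 0
    above-all x le = ⊥-elim (1+n≰n (≤-trans (≤-trans (m≤m+n top n) le) (≤-∑ ρ x)))

least : ∀ {P : ℕ → Set} → (∀ j → Dec (P j)) → ∀ J → P J →
        ∃ λ d → P d × (∀ j → j < d → ¬ P j)
least {P} P? = <-rec (λ J → P J → ∃ λ d → P d × (∀ j → j < d → ¬ P j)) search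
  where
  search : ∀ J → (∀ {j} → j < J → P j → ∃ λ d → P d × (∀ i → i < d → ¬ P i)) →
           P J → ∃ λ d → P d × (∀ j → j < d → ¬ P j)
  search J smaller PJ with anyUpTo? P? J
  ... | yes (j , j<J , Pj) = smaller j<J Pj
  ... | no  none           = J , PJ , λ j j<J Pj → none (j , j<J , Pj)

module Descent {n} (A : Fin n → Fin n → Set) (A? : ∀ u v → Dec (A u v))
               (r : Fin n) (reachable : ∀ v → Star A r v) where

  Near : ℕ → Fin n → Set
  Near zero    v = v ≡ r
  Near (suc j) v = Near j v ⊎ (∃ λ u → Near j u × A u v)

  near? : ∀ j v → Dec (Near j v)
  near? zero    v = v ≟ r
  near? (suc j) v = near? j v ⊎-dec Fin.any? (λ u → near? j u ×-dec A? u v)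

  near-path : ∀ {u v} → Star A u v → ∀ j → Near j u → ∃ λ j′ → Near j′ v
  near-path ε          j near = j , near
  near-path (a ◅ path) j near = near-path path (suc j) (inj₂ (_ , near , a))

  -- Kept opaque: only its specification matters, and unfolding the search
  -- during type checking would be costly.
  opaque
    closest : ∀ v → ∃ λ d → Near d v × (∀ j → j < d → ¬ Near j v)
    closest v = let (J , near) = near-path (reachable v) 0 refl in least (λ j → near? j v) J near

  height : Fin n → ℕ
  height v = proj₁ (closest v)

  height-least : ∀ v j → Near j v → height v ≤ j
  height-least v j near = ≮⇒≥ (λ j<h → proj₂ (proj₂ (closest v)) j j<h near)

  height-root : height r ≡ 0
  height-root = n≤0⇒n≡0 (height-least r 0 refl)

  parent : ∀ v → v ≢ r → ∃ λ u → A u v × height u < height v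
  parent v v≢r = from (closest v)
    where
    from : (c : ∃ λ d → Near d v × (∀ j → j < d → ¬ Near j v)) →
           ∃ λ u → A u v × height u < proj₁ c
    from (zero  , v≡r , _)                  = ⊥-elim (v≢r v≡r)
    from (suc j , inj₁ near , minimal)      = ⊥-elim (minimal j ≤-refl near)
    from (suc j , inj₂ (u , near , a) , _)  = u , a , s≤s (height-least u j near)

-- A spanning tree of a connected graph on the vertices 0, 1, …, m: BFS from
-- vertex 0 gives each vertex j + 1 a parent (up j) of smaller depth; the
-- j-th tree edge joins them.
module SpanningTree {m} (G : Graph (suc m)) (connected : Connected G) where

  open Descent (Adj G) (adjacent? G) fzero (connected fzero)
    renaming (height to depth; parent to bfs-parent)

  up : Fin m → Fin (suc m)
  up j = proj₁ (bfs-parent (fsuc j) (λ ()))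

  up-shallower : ∀ j → depth (up j) < depth (fsuc j)
  up-shallower j = proj₂ (proj₂ (bfs-parent (fsuc j) (λ ())))

  tree-edge : Fin m → Edge G
  tree-edge j = proj₁ (adjacent-edge G (proj₁ (proj₂ (bfs-parent (fsuc j) (λ ())))))

  tree-edge-along : ∀ j → Along G (tree-edge j) (up j) (fsuc j)
  tree-edge-along j = proj₂ (adjacent-edge G (proj₁ (proj₂ (bfs-parent (fsuc j) (λ ())))))

  -- Distinct tree edges: equal edges would make two vertices each
  -- other's parent, against the decrease of depth.
  tree-edge-injective : ∀ i j → tree-edge i ≡ tree-edge j → i ≡ j
  tree-edge-injective i j eq
    with Along-unique G (tree-edge-along i) (subst (λ e → Along G e (up j) (fsuc j)) (sym eq) (tree-edge-along j))
  ... | inj₁ (_ , si≡sj)     = Fin.suc-injective si≡sj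
  ... | inj₂ (ui≡sj , si≡uj) = ⊥-elim (<-asym (subst (λ v → depth v < depth (fsuc i)) ui≡sj (up-shallower i))
                                               (subst (λ v → depth v < depth (fsuc j)) (sym si≡uj) (up-shallower j)))

  Joins : Fin m → Fin (suc m) → Fin (suc m) → Set
  Joins j u v = (u ≡ up j × v ≡ fsuc j) ⊎ (u ≡ fsuc j × v ≡ up j)

  joins-along : ∀ {j u v} → Joins j u v → Along G (tree-edge j) u v
  joins-along {j} (inj₁ (refl , refl)) = tree-edge-along j
  joins-along {j} (inj₂ (refl , refl)) = Along-sym G (tree-edge-along j)

  TreeAdj : Fin (suc m) → Fin (suc m) → Set
  TreeAdj u v = ∃ λ j → Joins j u v

  tree-adjacent? : ∀ u v → Dec (TreeAdj u v)
  tree-adjacent? u v = Fin.any? (λ j → ((u ≟ up j) ×-dec (v ≟ fsuc j)) ⊎-dec ((u ≟ fsuc j) ×-dec (v ≟ up j)))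

  TreeAdj-sym : ∀ {u v} → TreeAdj u v → TreeAdj v u
  TreeAdj-sym (j , inj₁ (u≡ , v≡)) = j , inj₂ (v≡ , u≡)
  TreeAdj-sym (j , inj₂ (u≡ , v≡)) = j , inj₁ (v≡ , u≡)

  climb : ∀ v → Star TreeAdj v fzero
  climb v = <-rec (λ d → ∀ v → depth v ≡ d → Star TreeAdj v fzero) climb-from (depth v) v refl
    where
    climb-from : ∀ d → (∀ {d′} → d′ < d → ∀ v → depth v ≡ d′ → Star TreeAdj v fzero) →
           ∀ v → depth v ≡ d → Star TreeAdj v fzero
    climb-from d lower fzero    _  = ε
    climb-from d lower (fsuc j) eq =
      (j , inj₂ (refl , refl)) ◅ lower (subst (depth (up j) <_) eq (up-shallower j)) (up j) refl

  tree-connected : ∀ u v → Star TreeAdj u v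
  tree-connected u v = climb u ◅◅ reverse TreeAdj-sym (climb v)

half : ℕ → ℚ
half a = pos a ℚ./ 2

-- As an unnormalised rational, a / 2 is (2a) / 2 (the stored denominator
-- of mkℚᵘ p q is q + 1).
half-unnormalised : ∀ a → ℚ.toℚᵘ (half a) ℚᵘ.≃ mkℚᵘ (pos a) 1
half-unnormalised a = ℚ.toℚᵘ-fromℚᵘ (mkℚᵘ (pos a) 1)

half-+ : ∀ a b → half a ℚ.+ half b ≡ half (a + b)
half-+ a b = ℚ.toℚᵘ-injective (begin
  ℚ.toℚᵘ (half a ℚ.+ half b)                    ≈⟨ ℚ.toℚᵘ-homo-+ (half a) (half b) ⟩
  ℚ.toℚᵘ (half a) ℚᵘ.+ ℚ.toℚᵘ (half b)          ≈⟨ ℚᵘ.+-cong (half-unnormalised a) (half-unnormalised b) ⟩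
  mkℚᵘ (pos a) 1 ℚᵘ.+ mkℚᵘ (pos b) 1            ≈⟨ *≡* (trans (sum-of-halves (pos a) (pos b))
                                                             (cong (ℤ._* pos 4) (sym (ℤ.pos-+ a b)))) ⟩
  mkℚᵘ (pos (a + b)) 1                          ≈⟨ half-unnormalised (a + b) ⟨
  ℚ.toℚᵘ (half (a + b))                         ∎)
  where
  open ℚᵘ.≃-Reasoning
  sum-of-halves : ∀ x y → (x ℤ.* pos 2 ℤ.+ y ℤ.* pos 2) ℤ.* pos 2 ≡ (x ℤ.+ y) ℤ.* pos 4
  sum-of-halves = ℤ-solve-∀

foldr-half : ∀ {k} (f : Fin k → ℕ) → Vec.foldr ℚ._+_ 0ℚ (λ i → half (f i)) ≡ half (∑ f)
foldr-half {zero}  f = refl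
foldr-half {suc k} f = trans (cong (half (f fzero) ℚ.+_) (foldr-half (λ i → f (fsuc i))))
                             (half-+ (f fzero) (∑ (λ i → f (fsuc i))))

half-admissible : ∀ c → c ≤ 2 → (0ℚ ℚ.≤ half c) × (half c ℚ.≤ 1ℚ)
half-admissible 0 _ = toWitness {a? = 0ℚ ℚ.≤? half 0} tt , toWitness {a? = half 0 ℚ.≤? 1ℚ} tt
half-admissible 1 _ = toWitness {a? = 0ℚ ℚ.≤? half 1} tt , toWitness {a? = half 1 ℚ.≤? 1ℚ} tt
half-admissible 2 _ = toWitness {a? = 0ℚ ℚ.≤? half 2} tt , toWitness {a? = half 2 ℚ.≤? 1ℚ} tt
half-admissible (suc (suc (suc _))) (s≤s (s≤s ()))

cross-div : ∀ A b d → b * 2 ≡ A * suc d → A / 2 ≤ b / suc d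
cross-div A b d eq = begin
  A / 2                  ≡⟨ m*n/n≡m (A / 2) (suc d) ⟨
  A / 2 * suc d / suc d  ≤⟨ /-monoˡ-≤ (suc d) (*-cancelʳ-≤ (A / 2 * suc d) b 2 doubled) ⟩
  b / suc d              ∎
  where
  open ≤-Reasoning
  swap : ∀ x y → x * y * 2 ≡ x * 2 * y
  swap = solve-∀
  doubled : A / 2 * suc d * 2 ≤ b * 2
  doubled = begin
    A / 2 * suc d * 2  ≡⟨ swap (A / 2) (suc d) ⟩
    A / 2 * 2 * suc d  ≤⟨ *-monoˡ-≤ (suc d) (m/n*n≤m A 2) ⟩
    A * suc d          ≡⟨ eq ⟨
    b * 2              ∎

floor-half : ∀ p A → ℚ.toℚᵘ p ℚᵘ.≃ mkℚᵘ (pos A) 1 → A / 2 ≤ ℤ.∣ ℚ.floor p ∣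
floor-half (mkℚ (pos b) d _) A (*≡* eq) =
  ≤-trans (cross-div A b d (ℤ.+-injective (trans (ℤ.pos-* b 2) (trans eq (sym (ℤ.pos-* A (suc d)))))))
          (≤-reflexive (sym (trans (ℤ.abs-◃ _ _) (*-identityˡ (b / suc d)))))
floor-half (mkℚ -[1+ b ] d _) A (*≡* eq) with trans eq (ℤ.+◃n≡+n (A * suc d))
... | ()

floorMul-half : ∀ c a → (c * a) / 2 ≤ floorMul (half c) a
floorMul-half c a = floor-half _ (c * a) (begin
  ℚ.toℚᵘ (half c ℚ.* (pos a ℚ./ 1))               ≈⟨ ℚ.toℚᵘ-homo-* (half c) (pos a ℚ./ 1) ⟩
  ℚ.toℚᵘ (half c) ℚᵘ.* ℚ.toℚᵘ (pos a ℚ./ 1)       ≈⟨ ℚᵘ.*-cong (half-unnormalised c) (ℚ.toℚᵘ-fromℚᵘ (mkℚᵘ (pos a) 0)) ⟩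
  mkℚᵘ (pos c) 1 ℚᵘ.* mkℚᵘ (pos a) 0             ≈⟨ *≡* (cong (ℤ._* pos 2) (sym (ℤ.pos-* c a))) ⟩
  mkℚᵘ (pos (c * a)) 1                            ∎)
  where open ℚᵘ.≃-Reasoning

-- Hence weight 1 loses nothing and weight 1/2 halves (rounding down).
floorMul-halving : ∀ h → h ≤ 1 → ∀ a → a /2^ h ≤ floorMul (half (2 ∸ h)) a
floorMul-halving 0 _ a = begin
  a /2^ 0                 ≡⟨ n/1≡n a ⟩
  a                       ≡⟨ m*n/n≡m a 2 ⟨
  a * 2 / 2               ≡⟨ cong (_/ 2) (*-comm a 2) ⟩
  2 * a / 2               ≤⟨ floorMul-half 2 a ⟩
  floorMul (half 2) a     ∎
  where open ≤-Reasoning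
floorMul-halving 1 _ a = subst (_≤ floorMul (half 1) a) (cong (_/ 2) (*-identityˡ a)) (floorMul-half 1 a)
floorMul-halving (suc (suc _)) (s≤s ())

halves : ∀ {m} → ℕ → Fin m → ℕ
halves zero    _        = 0
halves (suc k) fzero    = 1
halves (suc k) (fsuc j) = halves k j

halves-≤1 : ∀ {m} k (j : Fin m) → halves k j ≤ 1
halves-≤1 zero    _        = z≤n
halves-≤1 (suc k) fzero    = ≤-refl
halves-≤1 (suc k) (fsuc j) = halves-≤1 k j

∑-halves : ∀ m k → k ≤ m → ∑ (halves {m} k) ≡ k
∑-halves m       zero    _         = ∑-zero {m} (λ _ → refl)
∑-halves (suc m) (suc k) (s≤s k≤m) = cong suc (∑-halves m k k≤m)

∑-const : ∀ m c → ∑ {m} (λ _ → c) ≡ m * c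
∑-const zero    c = refl
∑-const (suc m) c = cong (c +_) (∑-const m c)

∑-complement : ∀ m (h : Fin m → ℕ) → (∀ j → h j ≤ 2) → ∑ (λ j → 2 ∸ h j) + ∑ h ≡ m * 2
∑-complement m h h≤2 = begin
  ∑ (λ j → 2 ∸ h j) + ∑ h      ≡⟨ ∑-distrib-+ (λ j → 2 ∸ h j) h ⟨
  ∑ (λ j → (2 ∸ h j) + h j)    ≡⟨ sum-cong-≗ (λ j → m∸n+n≡m (h≤2 j)) ⟩
  ∑ {m} (λ _ → 2)              ≡⟨ ∑-const m 2 ⟩
  m * 2                        ∎
  where open ≡-Reasoning

module Construction {m} (G : Graph (suc m)) (connected : Connected G) (k : ℕ) where

  open SpanningTree G connected

  cost : Fin m → ℕ
  cost = halves k

  weight₂ : Edge G → ℕ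
  weight₂ e = ∑ (λ j → gate (tree-edge j ≟ e) (2 ∸ cost j))

  W : WeightFn G
  W e = half (weight₂ e)

  weight₂-tree : ∀ j → weight₂ (tree-edge j) ≡ 2 ∸ cost j
  weight₂-tree j = trans (∑-single _ j (λ i i≢j → if-no (i≢j ∘ tree-edge-injective i j) (tree-edge i ≟ tree-edge j)))
                         (if-yes refl (tree-edge j ≟ tree-edge j))

  weight₂-≤2 : ∀ e → weight₂ e ≤ 2
  weight₂-≤2 e with Fin.any? (λ j → tree-edge j ≟ e)
  ... | yes (j , refl) = ≤-trans (≤-reflexive (weight₂-tree j)) (m∸n≤m 2 (cost j))
  ... | no  off-tree   = ≤-trans (≤-reflexive (∑-zero (λ j → if-no (λ eq → off-tree (j , eq)) (tree-edge j ≟ e)))) z≤n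

  ∑-weight₂ : ∑ weight₂ ≡ ∑ (λ j → 2 ∸ cost j)
  ∑-weight₂ = trans (∑-comm (λ e j → gate (tree-edge j ≟ e) (2 ∸ cost j)))
                    (sum-cong-≗ (λ j → trans (∑-single _ (tree-edge j) (λ e e≢ → if-no (e≢ ∘ sym) (tree-edge j ≟ e)))
                                              (if-yes refl (tree-edge j ≟ tree-edge j))))

  tree-edge-delivers : ∀ j a → a /2^ cost j ≤ floorMul (W (tree-edge j)) a
  tree-edge-delivers j a = subst (λ w → a /2^ cost j ≤ floorMul (half w) a) (sym (weight₂-tree j))
                                 (floorMul-halving (cost j) (halves-≤1 k j) a)

  weight-distribution : IsWeightDistribution G W
  weight-distribution e = half-admissible (weight₂ e) (weight₂-≤2 e)

  total-weight : totalWeight G W ≡ half (∑ (λ j → 2 ∸ cost j))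
  total-weight = begin
    totalWeight G W                     ≡⟨ foldr-tabulate ℚ._+_ 0ℚ (∣E∣ G) (λ e → e) W ⟩
    Vec.foldr ℚ._+_ 0ℚ W                ≡⟨ foldr-half weight₂ ⟩
    half (∑ weight₂)                    ≡⟨ cong half ∑-weight₂ ⟩
    half (∑ (λ j → 2 ∸ cost j))         ∎
    where open ≡-Reasoning

  module Toward (t : Fin (suc m)) where

    open Descent TreeAdj tree-adjacent? t (tree-connected t)
      renaming (height to distance; height-root to distance-t)

    -- the endpoint of tree edge j farther from t, which pushes across it
    user : Fin m → Fin (suc m)
    user j = if does (distance (up j) ℕ.<? distance (fsuc j)) then fsuc j else up j

    user-farther : ∀ {j u x} → Joins j u x → distance u < distance x → user j ≡ x
    user-farther {j} (inj₁ (refl , refl)) u<x = if-yes u<x (distance (up j) ℕ.<? distance (fsuc j))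
    user-farther {j} (inj₂ (refl , refl)) u<x = if-no (<-asym u<x) (distance (up j) ℕ.<? distance (fsuc j))

    route-via : ∀ {x u} → TreeAdj u x → distance u < distance x → Route G W cost user distance x
    route-via {x} {u} (j , joins) u<x = record
      { next     = u
      ; edge     = tree-edge j
      ; along    = Along-sym G (joins-along joins)
      ; channel  = j
      ; reserved = user-farther joins u<x
      ; delivers = tree-edge-delivers j
      ; descends = u<x
      }

    route : ∀ x → x ≢ t → Route G W cost user distance x
    route x x≢t = let (_ , adj , u<x) = parent x x≢t in route-via adj u<x

    open Funnel G W t cost user distance distance-t route public using (reaches)

  -- the spanning tree has m distinct edges
  tree-fits : m ≤ ∣E∣ G
  tree-fits = Fin.injective⇒≤ (tree-edge-injective _ _)

  ∑-cost : k ≤ m → ∑ cost ≡ k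
  ∑-cost = ∑-halves m k

  half-total : k ≤ m → ∣E∣ G + k ≡ m * 2 → HalfTotal G W
  half-total k≤m |E|+k≡2m = trans total-weight (cong half (+-cancelʳ-≡ k _ _ (begin
    ∑ (λ j → 2 ∸ cost j) + k         ≡⟨ cong (∑ (λ j → 2 ∸ cost j) +_) (∑-cost k≤m) ⟨
    ∑ (λ j → 2 ∸ cost j) + ∑ cost    ≡⟨ ∑-complement m cost (λ j → ≤-trans (halves-≤1 k j) (s≤s z≤n)) ⟩
    m * 2                            ≡⟨ |E|+k≡2m ⟨
    ∣E∣ G + k                        ∎)))
    where open ≡-Reasoning

  solvable : k ≤ m → Solvable G W (2 ^ k)
  solvable k≤m C size≡ t =
    Toward.reaches t C (subst (λ c → 2 ^ c ≤ size C) (sym (∑-cost k≤m)) (≤-reflexive (sym size≡)))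

slack-≤ : ∀ {m E k} → m ≤ E → E + k ≡ m * 2 → k ≤ m
slack-≤ {m} {E} {k} m≤E eq = +-cancelˡ-≤ m k m (begin
  m + k        ≤⟨ +-monoˡ-≤ k m≤E ⟩
  E + k        ≡⟨ eq ⟩
  m * 2        ≡⟨ *-comm m 2 ⟩
  m + (m + 0)  ≡⟨ cong (m +_) (+-identityʳ m) ⟩
  m + m        ∎)
  where open ≤-Reasoning

edge-count : ∀ E k m → E + 2 + k ≡ 2 * suc m → E + k ≡ m * 2
edge-count E k m eq = +-cancelˡ-≡ 2 (E + k) (m * 2) (trans (shift E k) (trans eq (double m)))
  where
  shift : ∀ E k → 2 + (E + k) ≡ E + 2 + k
  shift = solve-∀
  double : ∀ m → 2 * suc m ≡ 2 + m * 2
  double = solve-∀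

proposition3 : (k n : ℕ) → 1 ≤ k → (G : Graph n) → Connected G →
               ∣E∣ G + 2 + k ≡ 2 * n → WpAtMost G (2 ^ k)
-- no graph without vertices has the required number of edges
proposition3 k zero    _ G _         count =
  ⊥-elim (n≮0 (≤-trans (m≤n+m 2 (∣E∣ G)) (≤-trans (m≤m+n _ k) (≤-reflexive count))))
proposition3 k (suc m) _ G connected count =
  2 ^ k , m^n>0 2 k , ≤-refl , W , weight-distribution , half-total k≤m |E|+k≡2m , solvable k≤m
  where
  open Construction G connected k
  |E|+k≡2m : ∣E∣ G + k ≡ m * 2
  |E|+k≡2m = edge-count (∣E∣ G) k m count
  k≤m : k ≤ m
  k≤m = slack-≤ tree-fits |E|+k≡2m
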